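{- Let $T$ be any proper binary tree with $\ell \geq 2$ leaves, and let $\mathbf{L} = (n_1, n_2, \ldots, n_k)$ be the binary power representation of $\ell$. Then $R(T) \leq R(T_{\mathbf{L}})$.
   Context: A proper binary tree is an unordered rooted tree in which every internal vertex has exactly two children. For a vertex $v$ of a rooted tree $T$, the rank (protection number) $R_T(v)$ is the minimum distance from $v$ to a leaf descendant of $v$ (a leaf has rank $0$), and the security of $T$ is $R(T) = \sum_{v \in V(T)} R_T(v)$. The binary power representation of $\ell$ is the vector $\mathbf{L} = (n_1, \ldots, n_k)$ with $\ell = \sum_{i=1}^k 2^{n_i}$ and $n_1 > n_2 > \cdots > n_k \geq 0$. The tree $T_{\mathbf{L}}$ is the proper binary tree rooted at $v_k$ constructed as follows: take a path $P = v_1 v_2 \ldots v_k$; identify $v_1$ with the root of a complete binary tree with $2^{n_1}$ leaves; and for each $2 \leq i \leq k$, join $v_i$ by an edge to the root $u_i$ of a complete binary tree with $2^{n_i}$ leaves. (Intuitively, $T_{\mathbf{L}}$ is a binary caterpillar whose $k$ pendant positions carry complete binary trees of heights $n_1, \ldots, n_k$, with the largest deepest.) -}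

module Defs where

open import Data.Nat using (ℕ; zero; suc; _+_; _^_; _⊓_; _>_)
open import Data.List using (List; []; _∷_; foldl; map)
open import Data.Nat.ListAction using (sum)
open import Data.List.Relation.Unary.Linked using (Linked)
open import Data.Product using (_×_)
open import Relation.Binary.PropositionalEquality using (_≡_)

-- Proper binary trees: every internal vertex has exactly two children.
-- (Child order is irrelevant for all quantities below, so ordered
-- representatives of the unordered trees suffice.)
data BTree : Set where
  leaf : BTree
  node : BTree → BTree → BTree

leaves : BTree → ℕ
leaves leaf       = 1
leaves (node l r) = leaves l + leaves r

rank : BTree → ℕ
rank leaf       = 0
rank (node l r) = suc (rank l ⊓ rank r)

security : BTree → ℕ
security leaf         = 0
security t@(node l r) = rank t + security l + security r

complete : ℕ → BTree
complete zero    = leaf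
complete (suc n) = node (complete n) (complete n)

IsBinPowRep : List ℕ → ℕ → Set
IsBinPowRep L ℓ = Linked _>_ L × sum (map (2 ^_) L) ≡ ℓ

-- T_L: v₁ is the root of complete(n₁); for i ≥ 2, vᵢ has children v_{i-1}
-- and the root uᵢ of complete(nᵢ); the tree is rooted at vₖ.
T[_] : List ℕ → BTree
T[ [] ]     = leaf   -- unused (ℓ ≥ 2 forces k ≥ 1)
T[ n ∷ ns ] = foldl (λ t m → node t (complete m)) (complete n) ns

{-# OPTIONS --safe #-}
module Submission where

-- Write s₂(ℓ) for the binary digit sum of ℓ. Every proper binary tree T with ℓ leaves satisfies
-- R(T) + ⌊log₂ ℓ⌋ + s₂(ℓ) + 1 ≤ 2ℓ, and T_L attains equality: n₁ = ⌊log₂ ℓ⌋, k = s₂(ℓ), and each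
-- complete tree of height m hung on the spine adds 2^(m+1) − 1 to the security. If the subtrees have ℓ₁ and ℓ₂ leaves, the root has
-- rank at most 1 + min(⌊log₂ ℓ₁⌋, ⌊log₂ ℓ₂⌋), while binary addition gives
-- ⌊log₂(ℓ₁ + ℓ₂)⌋ + s₂(ℓ₁ + ℓ₂) ≤ max(⌊log₂ ℓ₁⌋, ⌊log₂ ℓ₂⌋) + s₂(ℓ₁) + s₂(ℓ₂);
-- as min + max = ⌊log₂ ℓ₁⌋ + ⌊log₂ ℓ₂⌋, the bounds for the two subtrees add up to the bound for T.

open import Defs
open import Data.Nat using (ℕ; zero; suc; _+_; _*_; _^_; _⊓_; _⊔_; _≤_; _<_; _>_; z≤n; s≤s; s≤s⁻¹)
open import Data.Nat.Properties
open import Data.Nat.Tactic.RingSolver using (solve-∀)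
open import Data.Nat.ListAction using (sum)
open import Data.List using (List; []; _∷_; foldl; map; length)
open import Data.List.Relation.Unary.Linked using (Linked; _∷_)
open import Data.Product using (_,_)
open import Function using (_∘_)
open import Relation.Nullary using (contradiction)
open import Relation.Binary.PropositionalEquality

data Bin⁺ : Set where
  1b     : Bin⁺
  2×_    : Bin⁺ → Bin⁺
  1+2×_  : Bin⁺ → Bin⁺

toℕ : Bin⁺ → ℕ
toℕ 1b        = 1
toℕ (2× p)    = 2 * toℕ p
toℕ (1+2× p)  = 1 + 2 * toℕ p

⌊log₂_⌋ : Bin⁺ → ℕ
⌊log₂ 1b ⌋       = 0
⌊log₂ 2× p ⌋     = suc ⌊log₂ p ⌋
⌊log₂ 1+2× p ⌋   = suc ⌊log₂ p ⌋

popcount : Bin⁺ → ℕ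
popcount 1b        = 1
popcount (2× p)    = popcount p
popcount (1+2× p)  = suc (popcount p)

suc⁺ : Bin⁺ → Bin⁺
suc⁺ 1b        = 2× 1b
suc⁺ (2× p)    = 1+2× p
suc⁺ (1+2× p)  = 2× suc⁺ p

infixl 6 _+⁺_

_+⁺_ : Bin⁺ → Bin⁺ → Bin⁺
1b       +⁺ q        = suc⁺ q
p        +⁺ 1b       = suc⁺ p
(2× p)   +⁺ (2× q)   = 2× (p +⁺ q)
(2× p)   +⁺ (1+2× q) = 1+2× (p +⁺ q)
(1+2× p) +⁺ (2× q)   = 1+2× (p +⁺ q)
(1+2× p) +⁺ (1+2× q) = 2× suc⁺ (p +⁺ q)

2^⁺_ : ℕ → Bin⁺
2^⁺ zero  = 1b
2^⁺ suc m = 2× 2^⁺ m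

toℕ-positive : ∀ p → 0 < toℕ p
toℕ-positive 1b        = s≤s z≤n
toℕ-positive (2× p)    = *-monoʳ-< 2 (toℕ-positive p)
toℕ-positive (1+2× p)  = s≤s z≤n

toℕ-injective : ∀ {p q} → toℕ p ≡ toℕ q → p ≡ q
toℕ-injective {1b}       {1b}       _  = refl
toℕ-injective {1b}       {2× q}     eq = contradiction (sym eq) (even≢odd (toℕ q) 0)
toℕ-injective {1b}       {1+2× q}   eq =
  contradiction (*-cancelˡ-≡ (toℕ q) 0 2 (sym (suc-injective eq))) (>⇒≢ (toℕ-positive q))
toℕ-injective {2× p}     {1b}       eq = contradiction eq (even≢odd (toℕ p) 0)
toℕ-injective {2× p}     {2× q}     eq = cong 2×_ (toℕ-injective (*-cancelˡ-≡ _ _ 2 eq))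
toℕ-injective {2× p}     {1+2× q}   eq = contradiction eq (even≢odd (toℕ p) (toℕ q))
toℕ-injective {1+2× p}   {1b}       eq =
  contradiction (*-cancelˡ-≡ (toℕ p) 0 2 (suc-injective eq)) (>⇒≢ (toℕ-positive p))
toℕ-injective {1+2× p}   {2× q}     eq = contradiction (sym eq) (even≢odd (toℕ q) (toℕ p))
toℕ-injective {1+2× p}   {1+2× q}   eq =
  cong 1+2×_ (toℕ-injective (*-cancelˡ-≡ _ _ 2 (suc-injective eq)))

toℕ-suc⁺ : ∀ p → toℕ (suc⁺ p) ≡ suc (toℕ p)
toℕ-suc⁺ 1b        = refl
toℕ-suc⁺ (2× p)    = refl
toℕ-suc⁺ (1+2× p)  = trans (cong (2 *_) (toℕ-suc⁺ p)) (*-suc 2 (toℕ p))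

toℕ-+⁺ : ∀ p q → toℕ (p +⁺ q) ≡ toℕ p + toℕ q
2*-toℕ-+⁺ : ∀ p q → 2 * toℕ (p +⁺ q) ≡ 2 * toℕ p + 2 * toℕ q

toℕ-+⁺ 1b        q         = toℕ-suc⁺ q
toℕ-+⁺ (2× p)    1b        = +-comm 1 (2 * toℕ p)
toℕ-+⁺ (1+2× p)  1b        = trans (toℕ-suc⁺ (1+2× p)) (+-comm 1 (toℕ (1+2× p)))
toℕ-+⁺ (2× p)    (2× q)    = 2*-toℕ-+⁺ p q
toℕ-+⁺ (2× p)    (1+2× q)  =
  trans (cong suc (2*-toℕ-+⁺ p q)) (sym (+-suc (2 * toℕ p) (2 * toℕ q)))
toℕ-+⁺ (1+2× p)  (2× q)    = cong suc (2*-toℕ-+⁺ p q)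
toℕ-+⁺ (1+2× p)  (1+2× q)  = begin
  2 * toℕ (suc⁺ (p +⁺ q))            ≡⟨ cong (2 *_) (toℕ-suc⁺ (p +⁺ q)) ⟩
  2 * suc (toℕ (p +⁺ q))             ≡⟨ *-suc 2 (toℕ (p +⁺ q)) ⟩
  suc (suc (2 * toℕ (p +⁺ q)))       ≡⟨ cong (suc ∘ suc) (2*-toℕ-+⁺ p q) ⟩
  suc (suc (2 * toℕ p + 2 * toℕ q))  ≡⟨ cong suc (+-suc (2 * toℕ p) (2 * toℕ q)) ⟨
  toℕ (1+2× p) + toℕ (1+2× q)        ∎
  where open ≡-Reasoning

2*-toℕ-+⁺ p q = trans (cong (2 *_) (toℕ-+⁺ p q)) (*-distribˡ-+ 2 (toℕ p) (toℕ q))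

toℕ<2^suc⌊log₂⌋ : ∀ p → toℕ p < 2 ^ suc ⌊log₂ p ⌋
toℕ<2^suc⌊log₂⌋ 1b        = s≤s (s≤s z≤n)
toℕ<2^suc⌊log₂⌋ (2× p)    = *-monoʳ-< 2 (toℕ<2^suc⌊log₂⌋ p)
toℕ<2^suc⌊log₂⌋ (1+2× p)  =
  ≤-trans (≤-reflexive (sym (*-suc 2 (toℕ p)))) (*-monoʳ-≤ 2 (toℕ<2^suc⌊log₂⌋ p))

⌊log₂⌋+popcount-suc⁺ : ∀ p → ⌊log₂ suc⁺ p ⌋ + popcount (suc⁺ p) ≤ ⌊log₂ p ⌋ + suc (popcount p)
⌊log₂⌋+popcount-suc⁺ 1b        = ≤-refl
⌊log₂⌋+popcount-suc⁺ (2× p)    = ≤-refl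
⌊log₂⌋+popcount-suc⁺ (1+2× p)  =
  s≤s (≤-trans (⌊log₂⌋+popcount-suc⁺ p) (+-monoʳ-≤ ⌊log₂ p ⌋ (n≤1+n (suc (popcount p)))))

-- Each carry lowers the digit sum by one, and only a carry out of the top digit raises ⌊log₂⌋.
⌊log₂⌋+popcount-+⁺ : ∀ p q →
  ⌊log₂ p +⁺ q ⌋ + popcount (p +⁺ q) ≤ ⌊log₂ p ⌋ ⊔ ⌊log₂ q ⌋ + popcount p + popcount q
⌊log₂⌋+popcount-+⁺ 1b          q         =
  ≤-trans (⌊log₂⌋+popcount-suc⁺ q) (≤-reflexive (sym (+-assoc _ 1 _)))
⌊log₂⌋+popcount-+⁺ p@(2× _)    1b        =
  ≤-trans (⌊log₂⌋+popcount-suc⁺ p)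
          (≤-reflexive (trans (+-suc ⌊log₂ p ⌋ (popcount p)) (+-comm 1 _)))
⌊log₂⌋+popcount-+⁺ p@(1+2× _)  1b        =
  ≤-trans (⌊log₂⌋+popcount-suc⁺ p)
          (≤-reflexive (trans (+-suc ⌊log₂ p ⌋ (popcount p)) (+-comm 1 _)))
⌊log₂⌋+popcount-+⁺ (2× p)      (2× q)    = s≤s (⌊log₂⌋+popcount-+⁺ p q)
⌊log₂⌋+popcount-+⁺ (2× p)      (1+2× q)  = s≤s (begin
  ⌊log₂ p +⁺ q ⌋ + suc (popcount (p +⁺ q))  ≡⟨ +-suc _ _ ⟩
  suc (⌊log₂ p +⁺ q ⌋ + popcount (p +⁺ q))  ≤⟨ s≤s (⌊log₂⌋+popcount-+⁺ p q) ⟩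
  suc (⌊log₂ p ⌋ ⊔ ⌊log₂ q ⌋ + popcount p + popcount q)  ≡⟨ +-suc _ _ ⟨
  ⌊log₂ p ⌋ ⊔ ⌊log₂ q ⌋ + popcount p + suc (popcount q)  ∎)
  where open ≤-Reasoning
⌊log₂⌋+popcount-+⁺ (1+2× p)    (2× q)    = s≤s (begin
  ⌊log₂ p +⁺ q ⌋ + suc (popcount (p +⁺ q))  ≡⟨ +-suc _ _ ⟩
  suc (⌊log₂ p +⁺ q ⌋ + popcount (p +⁺ q))  ≤⟨ s≤s (⌊log₂⌋+popcount-+⁺ p q) ⟩
  suc (⌊log₂ p ⌋ ⊔ ⌊log₂ q ⌋ + popcount p + popcount q)  ≡⟨ cong (_+ popcount q) (+-suc _ _) ⟨
  ⌊log₂ p ⌋ ⊔ ⌊log₂ q ⌋ + suc (popcount p) + popcount q  ∎)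
  where open ≤-Reasoning
⌊log₂⌋+popcount-+⁺ (1+2× p)    (1+2× q)  = s≤s (begin
  ⌊log₂ suc⁺ (p +⁺ q) ⌋ + popcount (suc⁺ (p +⁺ q))  ≤⟨ ⌊log₂⌋+popcount-suc⁺ (p +⁺ q) ⟩
  ⌊log₂ p +⁺ q ⌋ + suc (popcount (p +⁺ q))          ≡⟨ +-suc _ _ ⟩
  suc (⌊log₂ p +⁺ q ⌋ + popcount (p +⁺ q))          ≤⟨ s≤s (⌊log₂⌋+popcount-+⁺ p q) ⟩
  suc (M + popcount p + popcount q)                 ≤⟨ n≤1+n _ ⟩
  suc (suc (M + popcount p + popcount q))           ≡⟨ cong suc (cong (_+ popcount q) (+-suc M _)) ⟨
  suc (M + suc (popcount p) + popcount q)           ≡⟨ +-suc _ _ ⟨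
  M + suc (popcount p) + suc (popcount q)           ∎)
  where
  open ≤-Reasoning
  M = ⌊log₂ p ⌋ ⊔ ⌊log₂ q ⌋

toℕ-2^⁺ : ∀ m → toℕ (2^⁺ m) ≡ 2 ^ m
toℕ-2^⁺ zero     = refl
toℕ-2^⁺ (suc m)  = cong (2 *_) (toℕ-2^⁺ m)

⌊log₂⌋-2^⁺ : ∀ m → ⌊log₂ 2^⁺ m ⌋ ≡ m
⌊log₂⌋-2^⁺ zero     = refl
⌊log₂⌋-2^⁺ (suc m)  = cong suc (⌊log₂⌋-2^⁺ m)

popcount-2^⁺ : ∀ m → popcount (2^⁺ m) ≡ 1
popcount-2^⁺ zero     = refl
popcount-2^⁺ (suc m)  = popcount-2^⁺ m

⌊log₂⌋-2^⁺-+⁺ : ∀ {m} p → ⌊log₂ p ⌋ < m → ⌊log₂ 2^⁺ m +⁺ p ⌋ ≡ m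
⌊log₂⌋-2^⁺-+⁺ {suc m} 1b        _  = cong suc (⌊log₂⌋-2^⁺ m)
⌊log₂⌋-2^⁺-+⁺ {suc m} (2× p)    lt = cong suc (⌊log₂⌋-2^⁺-+⁺ p (s≤s⁻¹ lt))
⌊log₂⌋-2^⁺-+⁺ {suc m} (1+2× p)  lt = cong suc (⌊log₂⌋-2^⁺-+⁺ p (s≤s⁻¹ lt))

popcount-2^⁺-+⁺ : ∀ {m} p → ⌊log₂ p ⌋ < m → popcount (2^⁺ m +⁺ p) ≡ suc (popcount p)
popcount-2^⁺-+⁺ {suc m} 1b        _  = cong suc (popcount-2^⁺ m)
popcount-2^⁺-+⁺ {suc m} (2× p)    lt = popcount-2^⁺-+⁺ p (s≤s⁻¹ lt)
popcount-2^⁺-+⁺ {suc m} (1+2× p)  lt = cong suc (popcount-2^⁺-+⁺ p (s≤s⁻¹ lt))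

fromExponents : ℕ → List ℕ → Bin⁺
fromExponents n []        = 2^⁺ n
fromExponents n (m ∷ ms)  = 2^⁺ n +⁺ fromExponents m ms

toℕ-fromExponents : ∀ n ns → toℕ (fromExponents n ns) ≡ sum (map (2 ^_) (n ∷ ns))
toℕ-fromExponents n []        = trans (toℕ-2^⁺ n) (sym (+-identityʳ (2 ^ n)))
toℕ-fromExponents n (m ∷ ms)  =
  trans (toℕ-+⁺ (2^⁺ n) (fromExponents m ms)) (cong₂ _+_ (toℕ-2^⁺ n) (toℕ-fromExponents m ms))

⌊log₂⌋-fromExponents : ∀ {n ns} → Linked _>_ (n ∷ ns) → ⌊log₂ fromExponents n ns ⌋ ≡ n
⌊log₂⌋-fromExponents {n} {[]}      _            = ⌊log₂⌋-2^⁺ n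
⌊log₂⌋-fromExponents {n} {m ∷ ms}  (m<n ∷ ms↓)  = ⌊log₂⌋-2^⁺-+⁺ (fromExponents m ms)
  (subst (_< n) (sym (⌊log₂⌋-fromExponents ms↓)) m<n)

popcount-fromExponents : ∀ {n ns} →
  Linked _>_ (n ∷ ns) → popcount (fromExponents n ns) ≡ length (n ∷ ns)
popcount-fromExponents {n} {[]}      _            = popcount-2^⁺ n
popcount-fromExponents {n} {m ∷ ms}  (m<n ∷ ms↓)  = trans
  (popcount-2^⁺-+⁺ (fromExponents m ms) (subst (_< n) (sym (⌊log₂⌋-fromExponents ms↓)) m<n))
  (cong suc (popcount-fromExponents ms↓))

leaves⁺ : BTree → Bin⁺
leaves⁺ leaf        = 1b
leaves⁺ (node l r)  = leaves⁺ l +⁺ leaves⁺ r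

toℕ-leaves⁺ : ∀ t → toℕ (leaves⁺ t) ≡ leaves t
toℕ-leaves⁺ leaf        = refl
toℕ-leaves⁺ (node l r)  =
  trans (toℕ-+⁺ (leaves⁺ l) (leaves⁺ r)) (cong₂ _+_ (toℕ-leaves⁺ l) (toℕ-leaves⁺ r))

2^rank≤leaves : ∀ t → 2 ^ rank t ≤ leaves t
2^rank≤leaves leaf        = ≤-refl
2^rank≤leaves (node l r)  = +-mono-≤
  (≤-trans (^-monoʳ-≤ 2 (m⊓n≤m (rank l) (rank r))) (2^rank≤leaves l))
  (≤-trans (≤-reflexive (+-identityʳ _))
           (≤-trans (^-monoʳ-≤ 2 (m⊓n≤n (rank l) (rank r))) (2^rank≤leaves r)))

2^m<2^n⇒m<n : ∀ {m n} → 2 ^ m < 2 ^ n → m < n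
2^m<2^n⇒m<n 2^m<2^n = ≰⇒> (<⇒≱ 2^m<2^n ∘ ^-monoʳ-≤ 2)

rank≤⌊log₂⌋-leaves⁺ : ∀ t → rank t ≤ ⌊log₂ leaves⁺ t ⌋
rank≤⌊log₂⌋-leaves⁺ t = s≤s⁻¹ (2^m<2^n⇒m<n (begin-strict
  2 ^ rank t                      ≤⟨ 2^rank≤leaves t ⟩
  leaves t                        ≡⟨ toℕ-leaves⁺ t ⟨
  toℕ (leaves⁺ t)                 <⟨ toℕ<2^suc⌊log₂⌋ (leaves⁺ t) ⟩
  2 ^ suc ⌊log₂ leaves⁺ t ⌋       ∎))
  where open ≤-Reasoning

m⊓n+m⊔n≡m+n : ∀ m n → m ⊓ n + (m ⊔ n) ≡ m + n
m⊓n+m⊔n≡m+n zero     n        = refl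
m⊓n+m⊔n≡m+n (suc m)  zero     = +-comm 0 (suc m)
m⊓n+m⊔n≡m+n (suc m)  (suc n)  = cong suc (begin
  m ⊓ n + suc (m ⊔ n)    ≡⟨ +-suc (m ⊓ n) (m ⊔ n) ⟩
  suc (m ⊓ n + (m ⊔ n))  ≡⟨ cong suc (m⊓n+m⊔n≡m+n m n) ⟩
  suc (m + n)            ≡⟨ +-suc m n ⟨
  m + suc n              ∎)
  where open ≡-Reasoning

security+⌊log₂⌋+popcount<2*leaves : ∀ t →
  security t + ⌊log₂ leaves⁺ t ⌋ + popcount (leaves⁺ t) < 2 * leaves t
security+⌊log₂⌋+popcount<2*leaves leaf        = ≤-refl
security+⌊log₂⌋+popcount<2*leaves (node l r)  = begin
  suc (suc (rank l ⊓ rank r) + sl + sr + ⌊log₂ p +⁺ q ⌋ + popcount (p +⁺ q))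
    ≡⟨ regroup₁ (rank l ⊓ rank r) sl sr ⌊log₂ p +⁺ q ⌋ (popcount (p +⁺ q)) ⟩
  2 + rank l ⊓ rank r + (sl + sr) + (⌊log₂ p +⁺ q ⌋ + popcount (p +⁺ q))
    ≤⟨ +-mono-≤ (+-monoˡ-≤ (sl + sr) (+-monoʳ-≤ 2 rank-bound)) (⌊log₂⌋+popcount-+⁺ p q) ⟩
  2 + lp ⊓ lq + (sl + sr) + (lp ⊔ lq + cp + cq)
    ≡⟨ regroup₂ (lp ⊓ lq) (lp ⊔ lq) sl sr cp cq ⟩
  lp ⊓ lq + (lp ⊔ lq) + (suc (sl + cp) + suc (sr + cq))
    ≡⟨ cong (_+ (suc (sl + cp) + suc (sr + cq))) (m⊓n+m⊔n≡m+n lp lq) ⟩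
  lp + lq + (suc (sl + cp) + suc (sr + cq))
    ≡⟨ regroup₃ lp lq sl sr cp cq ⟩
  suc (sl + lp + cp) + suc (sr + lq + cq)
    ≤⟨ +-mono-≤ (security+⌊log₂⌋+popcount<2*leaves l)
                (security+⌊log₂⌋+popcount<2*leaves r) ⟩
  2 * leaves l + 2 * leaves r
    ≡⟨ *-distribˡ-+ 2 (leaves l) (leaves r) ⟨
  2 * (leaves l + leaves r) ∎
  where
  open ≤-Reasoning
  p = leaves⁺ l
  q = leaves⁺ r
  sl = security l
  sr = security r
  lp = ⌊log₂ p ⌋
  lq = ⌊log₂ q ⌋
  cp = popcount p
  cq = popcount q
  rank-bound : rank l ⊓ rank r ≤ lp ⊓ lq
  rank-bound = ⊓-mono-≤ (rank≤⌊log₂⌋-leaves⁺ l) (rank≤⌊log₂⌋-leaves⁺ r)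
  regroup₁ : ∀ x s t u v → suc (suc x + s + t + u + v) ≡ 2 + x + (s + t) + (u + v)
  regroup₁ = solve-∀
  regroup₂ : ∀ x y s t c d → 2 + x + (s + t) + (y + c + d) ≡ x + y + (suc (s + c) + suc (t + d))
  regroup₂ = solve-∀
  regroup₃ : ∀ a b s t c d → a + b + (suc (s + c) + suc (t + d)) ≡ suc (s + a + c) + suc (t + b + d)
  regroup₃ = solve-∀

rank-complete : ∀ m → rank (complete m) ≡ m
rank-complete zero     = refl
rank-complete (suc m)  = cong suc (trans (⊓-idem (rank (complete m))) (rank-complete m))

leaves-complete : ∀ m → leaves (complete m) ≡ 2 ^ m
leaves-complete zero     = refl
leaves-complete (suc m)  =
  trans (cong₂ _+_ (leaves-complete m) (leaves-complete m)) (cong (2 ^ m +_) (sym (+-identityʳ (2 ^ m))))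

security-complete : ∀ m → security (complete m) + m + 2 ≡ 2 ^ suc m
security-complete zero     = refl
security-complete (suc m)  = begin
  rank (complete (suc m)) + s + s + suc m + 2
    ≡⟨ cong (λ x → x + s + s + suc m + 2) (rank-complete (suc m)) ⟩
  suc m + s + s + suc m + 2                    ≡⟨ regroup s m ⟩
  (s + m + 2) + (s + m + 2)                    ≡⟨ cong₂ _+_ (security-complete m) (security-complete m) ⟩
  2 ^ suc m + 2 ^ suc m                        ≡⟨ cong (2 ^ suc m +_) (+-identityʳ (2 ^ suc m)) ⟨
  2 ^ suc (suc m)                              ∎
  where
  open ≡-Reasoning
  s = security (complete m)
  regroup : ∀ s m → suc m + s + s + suc m + 2 ≡ (s + m + 2) + (s + m + 2)
  regroup = solve-∀

graft : BTree → ℕ → BTree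
graft t m = node t (complete m)

rank-graft : ∀ {t m} → m ≤ rank t → rank (graft t m) ≡ suc m
rank-graft {t} {m} m≤rank =
  cong suc (trans (cong (rank t ⊓_) (rank-complete m)) (m≥n⇒m⊓n≡n m≤rank))

security-graft : ∀ {t m} → m ≤ rank t → suc (security (graft t m)) ≡ security t + 2 ^ suc m
security-graft {t} {m} m≤rank = begin
  suc (rank (graft t m) + security t + s)  ≡⟨ cong (λ x → suc (x + security t + s)) (rank-graft m≤rank) ⟩
  suc (suc m + security t + s)             ≡⟨ regroup (security t) s m ⟩
  security t + (s + m + 2)                 ≡⟨ cong (security t +_) (security-complete m) ⟩
  security t + 2 ^ suc m                   ∎
  where
  open ≡-Reasoning
  s = security (complete m)
  regroup : ∀ u s m → suc (suc m + u + s) ≡ u + (s + m + 2)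
  regroup = solve-∀

leaves-foldl-graft : ∀ t ms → leaves (foldl graft t ms) ≡ leaves t + sum (map (2 ^_) ms)
leaves-foldl-graft t []        = sym (+-identityʳ (leaves t))
leaves-foldl-graft t (m ∷ ms)  = begin
  leaves (foldl graft (graft t m) ms)  ≡⟨ leaves-foldl-graft (graft t m) ms ⟩
  leaves t + leaves (complete m) + S   ≡⟨ cong (λ x → leaves t + x + S) (leaves-complete m) ⟩
  leaves t + 2 ^ m + S                 ≡⟨ +-assoc (leaves t) (2 ^ m) S ⟩
  leaves t + (2 ^ m + S)               ∎
  where
  open ≡-Reasoning
  S = sum (map (2 ^_) ms)

security-foldl-graft : ∀ {n} t ms → n ≤ rank t → Linked _>_ (n ∷ ms) →
  security (foldl graft t ms) + length ms ≡ security t + 2 * sum (map (2 ^_) ms)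
security-foldl-graft t []        _       _            = refl
security-foldl-graft t (m ∷ ms)  n≤rank  (m<n ∷ ms↓)  = begin
  security (foldl graft (graft t m) ms) + suc (length ms)  ≡⟨ +-suc _ (length ms) ⟩
  suc (security (foldl graft (graft t m) ms) + length ms)
    ≡⟨ cong suc (security-foldl-graft (graft t m) ms m≤rank′ ms↓) ⟩
  suc (security (graft t m)) + 2 * S                       ≡⟨ cong (_+ 2 * S) (security-graft m≤rank) ⟩
  security t + 2 ^ suc m + 2 * S                           ≡⟨ +-assoc (security t) _ _ ⟩
  security t + (2 * 2 ^ m + 2 * S)
    ≡⟨ cong (security t +_) (*-distribˡ-+ 2 (2 ^ m) S) ⟨
  security t + 2 * (2 ^ m + S)                             ∎
  where
  open ≡-Reasoning
  S = sum (map (2 ^_) ms)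
  m≤rank : m ≤ rank t
  m≤rank = ≤-trans (<⇒≤ m<n) n≤rank
  m≤rank′ : m ≤ rank (graft t m)
  m≤rank′ = ≤-trans (n≤1+n m) (≤-reflexive (sym (rank-graft m≤rank)))

security-T[] : ∀ {n ns} → Linked _>_ (n ∷ ns) →
  suc (security T[ n ∷ ns ] + n + length (n ∷ ns)) ≡ 2 * sum (map (2 ^_) (n ∷ ns))
security-T[] {n} {ns} ns↓ = begin
  suc (security T[ n ∷ ns ] + n + suc (length ns))  ≡⟨ regroup₁ (security T[ n ∷ ns ]) n (length ns) ⟩
  security T[ n ∷ ns ] + length ns + (n + 2)        ≡⟨ cong (_+ (n + 2)) spine ⟩
  security (complete n) + 2 * S + (n + 2)           ≡⟨ regroup₂ (security (complete n)) (2 * S) n ⟩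
  security (complete n) + n + 2 + 2 * S             ≡⟨ cong (_+ 2 * S) (security-complete n) ⟩
  2 * 2 ^ n + 2 * S                                 ≡⟨ *-distribˡ-+ 2 (2 ^ n) S ⟨
  2 * (2 ^ n + S)                                   ∎
  where
  open ≡-Reasoning
  S = sum (map (2 ^_) ns)
  spine : security T[ n ∷ ns ] + length ns ≡ security (complete n) + 2 * S
  spine = security-foldl-graft (complete n) ns (≤-reflexive (sym (rank-complete n))) ns↓
  regroup₁ : ∀ s n k → suc (s + n + suc k) ≡ s + k + (n + 2)
  regroup₁ = solve-∀
  regroup₂ : ∀ s u n → s + u + (n + 2) ≡ s + n + 2 + u
  regroup₂ = solve-∀

leaves⁺≡fromExponents : ∀ t {n ns} →
  IsBinPowRep (n ∷ ns) (leaves t) → leaves⁺ t ≡ fromExponents n ns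
leaves⁺≡fromExponents t {n} {ns} (_ , sum≡leaves) =
  toℕ-injective (trans (toℕ-leaves⁺ t) (sym (trans (toℕ-fromExponents n ns) sum≡leaves)))

theorem2p2 : (T : BTree) (L : List ℕ) → 2 ≤ leaves T →
    IsBinPowRep L (leaves T) → security T ≤ security T[ L ]
theorem2p2 T []        2≤ℓ  (_ , 0≡ℓ)           = contradiction (subst (2 ≤_) (sym 0≡ℓ) 2≤ℓ) λ ()
theorem2p2 T (n ∷ ns)  _    rep@(ns↓ , sum≡ℓ)  =
  +-cancelʳ-≤ n _ _ (+-cancelʳ-≤ (length (n ∷ ns)) _ _ (s≤s⁻¹ (begin
    suc (security T + n + length (n ∷ ns))
      ≡⟨ cong₂ (λ a b → suc (security T + a + b)) ⌊log₂⌋-leaves⁺ popcount-leaves⁺ ⟨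
    suc (security T + ⌊log₂ leaves⁺ T ⌋ + popcount (leaves⁺ T))  ≤⟨ security+⌊log₂⌋+popcount<2*leaves T ⟩
    2 * leaves T                                                 ≡⟨ cong (2 *_) sum≡ℓ ⟨
    2 * sum (map (2 ^_) (n ∷ ns))                                ≡⟨ security-T[] ns↓ ⟨
    suc (security T[ n ∷ ns ] + n + length (n ∷ ns))             ∎)))
  where
  open ≤-Reasoning
  ⌊log₂⌋-leaves⁺ : ⌊log₂ leaves⁺ T ⌋ ≡ n
  ⌊log₂⌋-leaves⁺ =
    trans (cong ⌊log₂_⌋ (leaves⁺≡fromExponents T rep)) (⌊log₂⌋-fromExponents ns↓)
  popcount-leaves⁺ : popcount (leaves⁺ T) ≡ length (n ∷ ns)
  popcount-leaves⁺ =
    trans (cong popcount (leaves⁺≡fromExponents T rep)) (popcount-fromExponents ns↓)
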